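{- Let $\mathrm{sort}$ be a sort function satisfying the extended characteristic property. Let $T$ be a type, $P : T \to \mathrm{bool}$ a predicate, and $\leq$ a relation on $T$ that is total and transitive on $P$, i.e. $x \leq y \vee y \leq x$ and $(x \leq y \wedge y \leq z \Rightarrow x \leq z)$ for all $x,y,z$ satisfying $P$. Then for every predicate $p : T \to \mathrm{bool}$ and every $xs : \mathrm{list}\,T$ all of whose elements satisfy $P$, $\mathrm{filter}\,p\,(\mathrm{sort}_\leq\,xs) = \mathrm{sort}_\leq\,(\mathrm{filter}\,p\,xs)$.
   Context: $\mathrm{filter}\,p\,xs$ is the list of the elements of $xs$ satisfying $p$, in their original order. Lists: $[]$ empty, $x :: s$ cons, $[x]$ singleton, $\mathbin{+\!\!+}$ concatenation, $\mathrm{rev}$ list reversal. A "relation" $\leq$ on a type $T$ is a function $T \to T \to \mathrm{bool}$. Merge: $[] \mathbin{\land\hspace{ -.45em}\land}_\leq ys = ys$, $xs \mathbin{\land\hspace{ -.45em}\land}_\leq [] = xs$, $(x :: xs) \mathbin{\land\hspace{ -.45em}\land}_\leq (y :: ys) = x :: (xs \mathbin{\land\hspace{ -.45em}\land}_\leq (y :: ys))$ if $x \leq y$, else $y :: ((x :: xs) \mathbin{\land\hspace{ -.45em}\land}_\leq ys)$. Define $xs \mathbin{\lor\hspace{ -.45em}\lor}_\leq ys := \mathrm{rev}\,(\mathrm{rev}\,ys \mathbin{\land\hspace{ -.45em}\land}_\geq \mathrm{rev}\,xs)$ where $\geq$ is the converse of $\leq$. A sort function assigns to every type $T$ and relation $\leq$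 on $T$ a function $\mathrm{sort}_\leq : \mathrm{list}\,T \to \mathrm{list}\,T$. It satisfies the extended characteristic property if there is a polymorphic $\mathrm{asort}$ of type $\forall (T\,R:\mathcal{U}), (T\to T\to\mathrm{bool}) \to (R\to R\to R)\to(R\to R\to R)\to(T\to R)\to R\to\mathrm{list}\,T\to R$ such that (1) $\mathrm{asort}\,(\leq)\,(\mathbin{\land\hspace{ -.45em}\land}_\leq)\,(\mathbin{\lor\hspace{ -.45em}\lor}_\leq)\,(\lambda x.[x])\,[]\,xs = \mathrm{sort}_\leq\,xs$ for all $T,\leq,xs$; (2) $\mathrm{asort}\,(\leq)\,(\mathbin{+\!\!+})\,(\mathbin{+\!\!+})\,(\lambda x.[x])\,[]\,xs = xs$ for all $T,\leq,xs$; (3) $\mathrm{asort}$ is relationally parametric: for all types $T_1,T_2$, relation $\sim_T\subseteq T_1\times T_2$, types $R_1,R_2$, relation $\sim_R\subseteq R_1\times R_2$, all $\leq_i : T_i\to T_i\to\mathrm{bool}$ with $x_1\sim_T x_2\wedge y_1\sim_T y_2 \Rightarrow (x_1\leq_1 y_1)=(x_2\leq_2 y_2)$, all $m_i, m'_i : R_i\to R_i\to R_i$ each pair preserving $\sim_R$ (i.e. $a_1\sim_R a_2\wedge b_1\sim_R b_2\Rightarrow m_1 a_1 b_1 \sim_R m_2 a_2 b_2$, and likewise for $m'$), all $s_i:T_i\to R_i$ with $x_1\sim_T x_2\Rightarrow s_1x_1\sim_R s_2x_2$, all $e_i : R_i$ with $e_1\sim_R e_2$, and all equal-length pointwise $\sim_T$-related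 lists $xs_1, xs_2$: $\mathrm{asort}\,(\leq_1)\,m_1\,m'_1\,s_1\,e_1\,xs_1 \sim_R \mathrm{asort}\,(\leq_2)\,m_2\,m'_2\,s_2\,e_2\,xs_2$. -}

module Defs where

open import Data.Bool using (Bool; true; false; if_then_else_)
open import Data.List using (List; []; _∷_; [_]; _++_; reverse)
open import Data.List.Relation.Binary.Pointwise using (Pointwise)
open import Relation.Binary.PropositionalEquality using (_≡_)

-- merge xs ys  (the paper's  xs ∧∧_≤ ys)
merge : {T : Set} → (T → T → Bool) → List T → List T → List T
merge {T} leq [] ys = ys
merge {T} leq (x ∷ xs) ys = go ys
  where
  go : List T → List T
  go [] = x ∷ xs
  go (y ∷ ys') = if leq x y then x ∷ merge leq xs (y ∷ ys') else y ∷ go ys'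

converse : {T : Set} → (T → T → Bool) → T → T → Bool
converse leq x y = leq y x

-- xs ∨∨_≤ ys := rev (rev ys ∧∧_≥ rev xs)
revMerge : {T : Set} → (T → T → Bool) → List T → List T → List T
revMerge leq xs ys = reverse (merge (converse leq) (reverse ys) (reverse xs))

SortFun : Set₁
SortFun = {T : Set} → (T → T → Bool) → List T → List T

ASortType : Set₁
ASortType = (T R : Set) → (T → T → Bool) → (R → R → R) → (R → R → R)
          → (T → R) → R → List T → R

Parametric : ASortType → Set₁
Parametric asort =
  (T₁ T₂ : Set) (_∼T_ : T₁ → T₂ → Set) (R₁ R₂ : Set) (_∼R_ : R₁ → R₂ → Set)
  (leq₁ : T₁ → T₁ → Bool) (leq₂ : T₂ → T₂ → Bool) →
  (∀ {x₁ x₂ y₁ y₂} → x₁ ∼T x₂ → y₁ ∼T y₂ → leq₁ x₁ y₁ ≡ leq₂ x₂ y₂) →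
  (m₁ m₁' : R₁ → R₁ → R₁) (m₂ m₂' : R₂ → R₂ → R₂) →
  (∀ {a₁ a₂ b₁ b₂} → a₁ ∼R a₂ → b₁ ∼R b₂ → m₁ a₁ b₁ ∼R m₂ a₂ b₂) →
  (∀ {a₁ a₂ b₁ b₂} → a₁ ∼R a₂ → b₁ ∼R b₂ → m₁' a₁ b₁ ∼R m₂' a₂ b₂) →
  (s₁ : T₁ → R₁) (s₂ : T₂ → R₂) →
  (∀ {x₁ x₂} → x₁ ∼T x₂ → s₁ x₁ ∼R s₂ x₂) →
  (e₁ : R₁) (e₂ : R₂) → e₁ ∼R e₂ →
  (xs₁ : List T₁) (xs₂ : List T₂) → Pointwise _∼T_ xs₁ xs₂ →
  asort T₁ R₁ leq₁ m₁ m₁' s₁ e₁ xs₁ ∼R asort T₂ R₂ leq₂ m₂ m₂' s₂ e₂ xs₂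

record ExtCharProp (sort : SortFun) : Set₁ where
  field
    asort       : ASortType
    asort-sort  : (T : Set) (leq : T → T → Bool) (xs : List T) →
                  asort T (List T) leq (merge leq) (revMerge leq) [_] [] xs ≡ sort leq xs
    asort-id    : (T : Set) (leq : T → T → Bool) (xs : List T) →
                  asort T (List T) leq _++_ _++_ [_] [] xs ≡ xs
    asort-param : Parametric asort

-- Insertion sort (insert x = [ x ] ∧∧ _) on a total preorder is stable.  Hence it commutes
-- with filtering, merging two insertion-sorted lists gives the insertion sort of their
-- concatenation, and so does reverse-merging, since reversing the stable ≤-sort of a list gives
-- the stable ≥-sort of the reversed list.  So the relation  u ∼ v :⇔ u = map f (isort v)  is
-- preserved by (∧∧, ∨∨) against (++, ++), and parametricity of asort together with
-- asort (++) (++) [_] [] = id yields  sort (map f v) = map f (isort v).  Taking f = proj₁ on the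
-- subtype of P-elements, where ≤ is a total preorder, the corollary becomes the commutation of
-- isort with filtering.
module Submission where

open import Defs
open import Data.Bool using (Bool; true; false; T)
open import Data.Bool.Properties using (T?)
open import Data.Sum using (_⊎_; inj₁; inj₂; reduce)
open import Data.Product using (∃; _,_; proj₁)
open import Data.Unit using (tt)
open import Data.List using (List; []; _∷_; [_]; _++_; foldr; map; reverse; filterᵇ)
open import Data.List.Properties
  using (filter-accept; filter-reject; unfold-reverse; reverse-++; reverse-involutive; reverse-map)
open import Data.List.Relation.Unary.All as All using (All; []; _∷_; toList)
open import Data.List.Relation.Unary.All.Properties using (anti-mono; filter⁺)
import Data.List.Relation.Unary.Any.Properties as Any
open import Data.List.Relation.Unary.AllPairs using (AllPairs; []; _∷_)
open import Data.List.Relation.Binary.Pointwise using (Pointwise; []; _∷_)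
open import Function using (_∘_; _on_)
open import Relation.Binary.Structures using (IsTotalPreorder)
import Relation.Binary.Construct.Flip.EqAndOrd as Flip
open import Relation.Binary.PropositionalEquality
  using (_≡_; refl; sym; trans; cong; cong₂; isEquivalence; module ≡-Reasoning)
open import Relation.Nullary using (¬_; yes; no; contradiction)

open ≡-Reasoning

module _ {B : Set} (_≤_ : B → B → Bool) where

  merge-≤ : ∀ {x y} xs ys → T (x ≤ y) → merge _≤_ (x ∷ xs) (y ∷ ys) ≡ x ∷ merge _≤_ xs (y ∷ ys)
  merge-≤ {x} {y} xs ys x≤y with x ≤ y
  ... | true = refl

  merge-≰ : ∀ {x y} xs ys → ¬ T (x ≤ y) → merge _≤_ (x ∷ xs) (y ∷ ys) ≡ y ∷ merge _≤_ (x ∷ xs) ys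
  merge-≰ {x} {y} xs ys x≰y with x ≤ y
  ... | true  = contradiction tt x≰y
  ... | false = refl

  merge-[]ʳ : ∀ xs → merge _≤_ xs [] ≡ xs
  merge-[]ʳ []       = refl
  merge-[]ʳ (x ∷ xs) = refl

  merge-all-≤ : ∀ {x} ys → All (λ y → T (y ≤ x)) ys → merge _≤_ ys [ x ] ≡ ys ++ [ x ]
  merge-all-≤ []       []           = refl
  merge-all-≤ (y ∷ ys) (y≤x ∷ ys≤x) = trans (merge-≤ ys [] y≤x) (cong (y ∷_) (merge-all-≤ ys ys≤x))

  merge-∷ʳ : ∀ {x y} ys → ¬ T (y ≤ x) → merge _≤_ (ys ++ [ y ]) [ x ] ≡ merge _≤_ ys [ x ] ++ [ y ]
  merge-∷ʳ     []       y≰x = merge-≰ [] [] y≰x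
  merge-∷ʳ {x} (z ∷ ys) y≰x with z ≤ x
  ... | true  = cong (z ∷_) (merge-∷ʳ ys y≰x)
  ... | false = refl

  insert : B → List B → List B
  insert x = merge _≤_ [ x ]

  isort : List B → List B
  isort = foldr insert []

  Sorted : List B → Set
  Sorted = AllPairs (λ x y → T (x ≤ y))

  insert-≤ : ∀ {x y} ys → T (x ≤ y) → insert x (y ∷ ys) ≡ x ∷ y ∷ ys
  insert-≤ = merge-≤ []

  insert-≰ : ∀ {x y} ys → ¬ T (x ≤ y) → insert x (y ∷ ys) ≡ y ∷ insert x ys
  insert-≰ = merge-≰ []

  insert-all-≤ : ∀ {x} ys → All (λ y → T (x ≤ y)) ys → insert x ys ≡ x ∷ ys
  insert-all-≤ []       []          = refl
  insert-all-≤ (y ∷ ys) (x≤y ∷ _) = insert-≤ ys x≤y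

  insert⁺ : ∀ {Q : B → Set} {x} ys → Q x → All Q ys → All Q (insert x ys)
  insert⁺ []                 qx []         = qx ∷ []
  insert⁺ {x = x} (y ∷ ys) qx (qy ∷ qys) with x ≤ y
  ... | true  = qx ∷ qy ∷ qys
  ... | false = qy ∷ insert⁺ ys qx qys

  filterᵇ-insert-reject : ∀ (p : B → Bool) {x} ys → ¬ T (p x) → filterᵇ p (insert x ys) ≡ filterᵇ p ys
  filterᵇ-insert-reject p []           ¬px = filter-reject (T? ∘ p) ¬px
  filterᵇ-insert-reject p {x} (y ∷ ys) ¬px with x ≤ y
  ... | true  = filter-reject (T? ∘ p) ¬px
  ... | false with p y
  ...   | true  = cong (y ∷_) (filterᵇ-insert-reject p ys ¬px)
  ...   | false = filterᵇ-insert-reject p ys ¬px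

IsTotalPreorderᵇ : {B : Set} → (B → B → Bool) → Set
IsTotalPreorderᵇ _≤_ = IsTotalPreorder _≡_ (λ x y → T (x ≤ y))

module TotalPreorderᵇ {B : Set} {_≤_ : B → B → Bool} (O : IsTotalPreorderᵇ _≤_) where

  open IsTotalPreorder O using (total) renaming (trans to ≤-trans)

  ≰⇒≥ : ∀ {x y} → ¬ T (x ≤ y) → T (y ≤ x)
  ≰⇒≥ {x} {y} x≰y with total x y
  ... | inj₁ x≤y = contradiction x≤y x≰y
  ... | inj₂ y≤x = y≤x

  merge-insert-≰ : ∀ {x y z} ys zs → ¬ T (x ≤ z) → ¬ T (y ≤ z) →
    merge _≤_ (insert _≤_ x (y ∷ ys)) zs ≡ insert _≤_ x (merge _≤_ (y ∷ ys) zs) →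
    merge _≤_ (insert _≤_ x (y ∷ ys)) (z ∷ zs) ≡ insert _≤_ x (merge _≤_ (y ∷ ys) (z ∷ zs))
  merge-insert-≰ {x} {y} {z} ys zs x≰z y≰z ih = begin
    merge _≤_ (insert _≤_ x (y ∷ ys)) (z ∷ zs) ≡⟨ z-first ⟩
    z ∷ merge _≤_ (insert _≤_ x (y ∷ ys)) zs   ≡⟨ cong (z ∷_) ih ⟩
    z ∷ insert _≤_ x (merge _≤_ (y ∷ ys) zs)   ≡⟨ insert-≰ _≤_ _ x≰z ⟨
    insert _≤_ x (z ∷ merge _≤_ (y ∷ ys) zs)   ≡⟨ cong (insert _≤_ x) (merge-≰ _≤_ ys zs y≰z) ⟨
    insert _≤_ x (merge _≤_ (y ∷ ys) (z ∷ zs)) ∎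
    where
    z-first : merge _≤_ (insert _≤_ x (y ∷ ys)) (z ∷ zs) ≡ z ∷ merge _≤_ (insert _≤_ x (y ∷ ys)) zs
    z-first with x ≤ y
    ... | true  = merge-≰ _≤_ (y ∷ ys) zs x≰z
    ... | false = merge-≰ _≤_ (insert _≤_ x ys) zs y≰z

  -- The two induction hypotheses are arguments so that merge-insert recurses structurally.
  merge-insert-∷ : ∀ {x y z} ys zs →
    merge _≤_ (insert _≤_ x ys) (z ∷ zs) ≡ insert _≤_ x (merge _≤_ ys (z ∷ zs)) →
    merge _≤_ (insert _≤_ x (y ∷ ys)) zs ≡ insert _≤_ x (merge _≤_ (y ∷ ys) zs) →
    merge _≤_ (insert _≤_ x (y ∷ ys)) (z ∷ zs) ≡ insert _≤_ x (merge _≤_ (y ∷ ys) (z ∷ zs))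
  merge-insert-∷ {x} {y} {z} ys zs ihˡ ihʳ with T? (x ≤ y)
  ... | yes x≤y with T? (x ≤ z)
  ...   | yes x≤z = begin
          merge _≤_ (insert _≤_ x (y ∷ ys)) (z ∷ zs) ≡⟨ cong (λ u → merge _≤_ u (z ∷ zs)) (insert-≤ _≤_ ys x≤y) ⟩
          merge _≤_ (x ∷ y ∷ ys) (z ∷ zs)            ≡⟨ merge-≤ _≤_ (y ∷ ys) zs x≤z ⟩
          x ∷ merge _≤_ (y ∷ ys) (z ∷ zs)            ≡⟨ insert-below-heads ⟨
          insert _≤_ x (merge _≤_ (y ∷ ys) (z ∷ zs)) ∎
    where
    insert-below-heads : insert _≤_ x (merge _≤_ (y ∷ ys) (z ∷ zs)) ≡ x ∷ merge _≤_ (y ∷ ys) (z ∷ zs)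
    insert-below-heads with y ≤ z
    ... | true  = insert-≤ _≤_ _ x≤y
    ... | false = insert-≤ _≤_ _ x≤z
  ...   | no  x≰z = merge-insert-≰ ys zs x≰z (λ y≤z → x≰z (≤-trans x≤y y≤z)) ihʳ
  merge-insert-∷ {x} {y} {z} ys zs ihˡ ihʳ | no x≰y with T? (y ≤ z)
  ...   | yes y≤z = begin
          merge _≤_ (insert _≤_ x (y ∷ ys)) (z ∷ zs) ≡⟨ cong (λ u → merge _≤_ u (z ∷ zs)) (insert-≰ _≤_ ys x≰y) ⟩
          merge _≤_ (y ∷ insert _≤_ x ys) (z ∷ zs)   ≡⟨ merge-≤ _≤_ (insert _≤_ x ys) zs y≤z ⟩
          y ∷ merge _≤_ (insert _≤_ x ys) (z ∷ zs)   ≡⟨ cong (y ∷_) ihˡ ⟩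
          y ∷ insert _≤_ x (merge _≤_ ys (z ∷ zs))   ≡⟨ insert-≰ _≤_ _ x≰y ⟨
          insert _≤_ x (y ∷ merge _≤_ ys (z ∷ zs))   ≡⟨ cong (insert _≤_ x) (merge-≤ _≤_ ys zs y≤z) ⟨
          insert _≤_ x (merge _≤_ (y ∷ ys) (z ∷ zs)) ∎
  ...   | no  y≰z = merge-insert-≰ ys zs (λ x≤z → y≰z (≤-trans (≰⇒≥ x≰y) x≤z)) y≰z ihʳ

  merge-insert : ∀ x ys zs → merge _≤_ (insert _≤_ x ys) zs ≡ insert _≤_ x (merge _≤_ ys zs)
  merge-insert x []       zs       = refl
  merge-insert x (y ∷ ys) []       = merge-[]ʳ _≤_ (insert _≤_ x (y ∷ ys))
  merge-insert x (y ∷ ys) (z ∷ zs) =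
    merge-insert-∷ ys zs (merge-insert x ys (z ∷ zs)) (merge-insert x (y ∷ ys) zs)

  merge-isort : ∀ xs ys → merge _≤_ (isort _≤_ xs) (isort _≤_ ys) ≡ isort _≤_ (xs ++ ys)
  merge-isort []       ys = refl
  merge-isort (x ∷ xs) ys =
    trans (merge-insert x (isort _≤_ xs) (isort _≤_ ys)) (cong (insert _≤_ x) (merge-isort xs ys))

  ≤-all-∷ : ∀ {x y zs} → T (x ≤ y) → All (λ z → T (y ≤ z)) zs → All (λ z → T (x ≤ z)) (y ∷ zs)
  ≤-all-∷ x≤y y≤zs = x≤y ∷ All.map (≤-trans x≤y) y≤zs

  insert-sorted : ∀ x ys → Sorted _≤_ ys → Sorted _≤_ (insert _≤_ x ys)
  insert-sorted x []       []                = [] ∷ []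
  insert-sorted x (y ∷ ys) (y≤ys ∷ ys-sorted) with T? (x ≤ y)
  ... | yes x≤y rewrite insert-≤ _≤_ ys x≤y = ≤-all-∷ x≤y y≤ys ∷ y≤ys ∷ ys-sorted
  ... | no  x≰y rewrite insert-≰ _≤_ ys x≰y = insert⁺ _≤_ ys (≰⇒≥ x≰y) y≤ys ∷ insert-sorted x ys ys-sorted

  isort-sorted : ∀ xs → Sorted _≤_ (isort _≤_ xs)
  isort-sorted []       = []
  isort-sorted (x ∷ xs) = insert-sorted x (isort _≤_ xs) (isort-sorted xs)

  filterᵇ-insert-accept : ∀ (p : B → Bool) {x} ys → Sorted _≤_ ys → T (p x) →
                          filterᵇ p (insert _≤_ x ys) ≡ insert _≤_ x (filterᵇ p ys)
  filterᵇ-insert-accept p []       []                px = filter-accept (T? ∘ p) px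
  filterᵇ-insert-accept p {x} (y ∷ ys) (y≤ys ∷ ys-sorted) px with T? (x ≤ y)
  ... | yes x≤y = begin
        filterᵇ p (insert _≤_ x (y ∷ ys)) ≡⟨ cong (filterᵇ p) (insert-≤ _≤_ ys x≤y) ⟩
        filterᵇ p (x ∷ y ∷ ys)            ≡⟨ filter-accept (T? ∘ p) px ⟩
        x ∷ filterᵇ p (y ∷ ys)            ≡⟨ insert-all-≤ _≤_ _ (filter⁺ (T? ∘ p) (≤-all-∷ x≤y y≤ys)) ⟨
        insert _≤_ x (filterᵇ p (y ∷ ys)) ∎
  ... | no  x≰y rewrite insert-≰ _≤_ ys x≰y with p y
  ...   | true  = trans (cong (y ∷_) (filterᵇ-insert-accept p ys ys-sorted px)) (sym (insert-≰ _≤_ _ x≰y))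
  ...   | false = filterᵇ-insert-accept p ys ys-sorted px

  filterᵇ-isort : ∀ (p : B → Bool) xs → filterᵇ p (isort _≤_ xs) ≡ isort _≤_ (filterᵇ p xs)
  filterᵇ-isort p []       = refl
  filterᵇ-isort p (x ∷ xs) with T? (p x)
  ... | yes px = begin
        filterᵇ p (insert _≤_ x (isort _≤_ xs)) ≡⟨ filterᵇ-insert-accept p (isort _≤_ xs) (isort-sorted xs) px ⟩
        insert _≤_ x (filterᵇ p (isort _≤_ xs)) ≡⟨ cong (insert _≤_ x) (filterᵇ-isort p xs) ⟩
        insert _≤_ x (isort _≤_ (filterᵇ p xs)) ≡⟨ cong (isort _≤_) (filter-accept (T? ∘ p) px) ⟨
        isort _≤_ (filterᵇ p (x ∷ xs))          ∎
  ... | no ¬px = begin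
        filterᵇ p (insert _≤_ x (isort _≤_ xs)) ≡⟨ filterᵇ-insert-reject _≤_ p (isort _≤_ xs) ¬px ⟩
        filterᵇ p (isort _≤_ xs)                ≡⟨ filterᵇ-isort p xs ⟩
        isort _≤_ (filterᵇ p xs)                ≡⟨ cong (isort _≤_) (filter-reject (T? ∘ p) ¬px) ⟨
        isort _≤_ (filterᵇ p (x ∷ xs))          ∎

  reverse-insert : ∀ x ys → Sorted _≤_ ys → reverse (insert _≤_ x ys) ≡ merge (converse _≤_) (reverse ys) [ x ]
  reverse-insert x []       []                = refl
  reverse-insert x (y ∷ ys) (y≤ys ∷ ys-sorted) with T? (x ≤ y)
  ... | yes x≤y = begin
        reverse (insert _≤_ x (y ∷ ys)) ≡⟨ cong reverse (insert-≤ _≤_ ys x≤y) ⟩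
        reverse (x ∷ y ∷ ys)            ≡⟨ unfold-reverse x (y ∷ ys) ⟩
        reverse (y ∷ ys) ++ [ x ]       ≡⟨ merge-all-≤ (converse _≤_) _ (anti-mono Any.reverse⁻ (≤-all-∷ x≤y y≤ys)) ⟨
        merge (converse _≤_) (reverse (y ∷ ys)) [ x ] ∎
  ... | no  x≰y = begin
        reverse (insert _≤_ x (y ∷ ys))
          ≡⟨ cong reverse (insert-≰ _≤_ ys x≰y) ⟩
        reverse (y ∷ insert _≤_ x ys)
          ≡⟨ unfold-reverse y (insert _≤_ x ys) ⟩
        reverse (insert _≤_ x ys) ++ [ y ]
          ≡⟨ cong (_++ [ y ]) (reverse-insert x ys ys-sorted) ⟩
        merge (converse _≤_) (reverse ys) [ x ] ++ [ y ]
          ≡⟨ merge-∷ʳ (converse _≤_) (reverse ys) x≰y ⟨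
        merge (converse _≤_) (reverse ys ++ [ y ]) [ x ]
          ≡⟨ cong (λ u → merge (converse _≤_) u [ x ]) (unfold-reverse y ys) ⟨
        merge (converse _≤_) (reverse (y ∷ ys)) [ x ] ∎

module _ {B : Set} {_≤_ : B → B → Bool} (O : IsTotalPreorderᵇ _≤_) where

  private
    module ≤ = TotalPreorderᵇ O
    module ≥ = TotalPreorderᵇ {_≤_ = converse _≤_} (Flip.isTotalPreorder O)

  reverse-isort : ∀ xs → reverse (isort _≤_ xs) ≡ isort (converse _≤_) (reverse xs)
  reverse-isort []       = refl
  reverse-isort (x ∷ xs) = begin
    reverse (insert _≤_ x (isort _≤_ xs))
      ≡⟨ ≤.reverse-insert x _ (≤.isort-sorted xs) ⟩
    merge (converse _≤_) (reverse (isort _≤_ xs)) [ x ]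
      ≡⟨ cong (λ u → merge (converse _≤_) u [ x ]) (reverse-isort xs) ⟩
    merge (converse _≤_) (isort (converse _≤_) (reverse xs)) [ x ]
      ≡⟨ ≥.merge-isort (reverse xs) [ x ] ⟩
    isort (converse _≤_) (reverse xs ++ [ x ])
      ≡⟨ cong (isort (converse _≤_)) (unfold-reverse x xs) ⟨
    isort (converse _≤_) (reverse (x ∷ xs)) ∎

  revMerge-isort : ∀ xs ys → revMerge _≤_ (isort _≤_ xs) (isort _≤_ ys) ≡ isort _≤_ (xs ++ ys)
  revMerge-isort xs ys = begin
    reverse (merge (converse _≤_) (reverse (isort _≤_ ys)) (reverse (isort _≤_ xs)))
      ≡⟨ cong₂ (λ u v → reverse (merge (converse _≤_) u v)) (reverse-isort ys) (reverse-isort xs) ⟩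
    reverse (merge (converse _≤_) (isort (converse _≤_) (reverse ys)) (isort (converse _≤_) (reverse xs)))
      ≡⟨ cong reverse (≥.merge-isort (reverse ys) (reverse xs)) ⟩
    reverse (isort (converse _≤_) (reverse ys ++ reverse xs))
      ≡⟨ cong (reverse ∘ isort (converse _≤_)) (reverse-++ xs ys) ⟨
    reverse (isort (converse _≤_) (reverse (xs ++ ys)))
      ≡⟨ cong reverse (reverse-isort (xs ++ ys)) ⟨
    reverse (reverse (isort _≤_ (xs ++ ys)))
      ≡⟨ reverse-involutive (isort _≤_ (xs ++ ys)) ⟩
    isort _≤_ (xs ++ ys) ∎

map-merge : ∀ {B C : Set} (_≤_ : B → B → Bool) (f : C → B) xs ys →
            map f (merge (_≤_ on f) xs ys) ≡ merge _≤_ (map f xs) (map f ys)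
map-merge _≤_ f []       ys = refl
map-merge _≤_ f (x ∷ xs) ys = map-merge-∷ ys
  where
  map-merge-∷ : ∀ ys → map f (merge (_≤_ on f) (x ∷ xs) ys) ≡ merge _≤_ (map f (x ∷ xs)) (map f ys)
  map-merge-∷ []       = refl
  map-merge-∷ (y ∷ ys) with f x ≤ f y
  ... | true  = cong (f x ∷_) (map-merge _≤_ f xs (y ∷ ys))
  ... | false = cong (f y ∷_) (map-merge-∷ ys)

map-revMerge : ∀ {B C : Set} (_≤_ : B → B → Bool) (f : C → B) xs ys →
               map f (revMerge (_≤_ on f) xs ys) ≡ revMerge _≤_ (map f xs) (map f ys)
map-revMerge _≤_ f xs ys = begin
  map f (reverse (merge (converse (_≤_ on f)) (reverse ys) (reverse xs)))
    ≡⟨ reverse-map f (merge (converse (_≤_ on f)) (reverse ys) (reverse xs)) ⟩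
  reverse (map f (merge (converse (_≤_ on f)) (reverse ys) (reverse xs)))
    ≡⟨ cong reverse (map-merge (converse _≤_) f (reverse ys) (reverse xs)) ⟩
  reverse (merge (converse _≤_) (map f (reverse ys)) (map f (reverse xs)))
    ≡⟨ cong₂ (λ u v → reverse (merge (converse _≤_) u v)) (reverse-map f ys) (reverse-map f xs) ⟩
  revMerge _≤_ (map f xs) (map f ys) ∎

sort-map : ∀ {sort : SortFun} → ExtCharProp sort → ∀ {A B : Set} (_≤_ : A → A → Bool) (f : B → A) →
           IsTotalPreorderᵇ (_≤_ on f) → ∀ ys → sort _≤_ (map f ys) ≡ map f (isort (_≤_ on f) ys)
sort-map {sort} sort-char {A} {B} _≤_ f O ys = begin
  sort _≤_ (map f ys)
    ≡⟨ asort-sort A _≤_ (map f ys) ⟨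
  asort A (List A) _≤_ (merge _≤_) (revMerge _≤_) [_] [] (map f ys)
    ≡⟨ asort-param A B (λ x y → x ≡ f y) (List A) (List B) _≈_ _≤_ (_≤_ on f) (λ { refl refl → refl })
         (merge _≤_) (revMerge _≤_) _++_ _++_
         (λ {a₂ = us} {b₂ = vs} → merge-≈ us vs) (λ {a₂ = us} {b₂ = vs} → revMerge-≈ us vs)
         [_] [_] (λ { refl → refl }) [] [] refl (map f ys) ys (graph ys) ⟩
  map f (isort (_≤_ on f) (asort B (List B) (_≤_ on f) _++_ _++_ [_] [] ys))
    ≡⟨ cong (map f ∘ isort (_≤_ on f)) (asort-id B (_≤_ on f) ys) ⟩
  map f (isort (_≤_ on f) ys) ∎
  where
  open ExtCharProp sort-char

  _≈_ : List A → List B → Set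
  us ≈ vs = us ≡ map f (isort (_≤_ on f) vs)

  merge-≈ : ∀ us vs {us′ vs′} → us′ ≈ us → vs′ ≈ vs → merge _≤_ us′ vs′ ≈ (us ++ vs)
  merge-≈ us vs refl refl =
    trans (sym (map-merge _≤_ f (isort (_≤_ on f) us) (isort (_≤_ on f) vs)))
          (cong (map f) (TotalPreorderᵇ.merge-isort O us vs))

  revMerge-≈ : ∀ us vs {us′ vs′} → us′ ≈ us → vs′ ≈ vs → revMerge _≤_ us′ vs′ ≈ (us ++ vs)
  revMerge-≈ us vs refl refl =
    trans (sym (map-revMerge _≤_ f (isort (_≤_ on f) us) (isort (_≤_ on f) vs)))
          (cong (map f) (revMerge-isort O us vs))

  graph : ∀ ys → Pointwise (λ x y → x ≡ f y) (map f ys) ys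
  graph []       = []
  graph (y ∷ ys) = refl ∷ graph ys

filterᵇ-map : ∀ {A B : Set} (p : A → Bool) (f : B → A) xs → filterᵇ p (map f xs) ≡ map f (filterᵇ (p ∘ f) xs)
filterᵇ-map p f []       = refl
filterᵇ-map p f (x ∷ xs) with p (f x)
... | true  = cong (f x ∷_) (filterᵇ-map p f xs)
... | false = filterᵇ-map p f xs

map-proj₁-toList : ∀ {A : Set} {Q : A → Set} {xs} (qs : All Q xs) → map proj₁ (toList qs) ≡ xs
map-proj₁-toList []       = refl
map-proj₁-toList (q ∷ qs) = cong (_ ∷_) (map-proj₁-toList qs)

restrict-isTotalPreorderᵇ : ∀ {A : Set} (P : A → Bool) (_≤_ : A → A → Bool) →
  (∀ x y → T (P x) → T (P y) → T (x ≤ y) ⊎ T (y ≤ x)) →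
  (∀ x y z → T (P x) → T (P y) → T (P z) → T (x ≤ y) → T (y ≤ z) → T (x ≤ z)) →
  IsTotalPreorderᵇ (_≤_ on proj₁ {B = T ∘ P})
restrict-isTotalPreorderᵇ P _≤_ total trans = record
  { isPreorder = record
    { isEquivalence = isEquivalence
    ; reflexive     = λ { {x , px} refl → reduce (total x x px px) }
    ; trans         = λ { {x , px} {y , py} {z , pz} → trans x y z px py pz }
    }
  ; total = λ (x , px) (y , py) → total x y px py
  }

corollary5p2 : (sort : SortFun) → ExtCharProp sort →
    (A : Set) (P : A → Bool) (leq : A → A → Bool) →
    (∀ x y → T (P x) → T (P y) → T (leq x y) ⊎ T (leq y x)) →
    (∀ x y z → T (P x) → T (P y) → T (P z) → T (leq x y) → T (leq y z) → T (leq x z)) →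
    (p : A → Bool) (xs : List A) → All (λ x → T (P x)) xs →
    filterᵇ p (sort leq xs) ≡ sort leq (filterᵇ p xs)
corollary5p2 sort sort-char A P _≤_ total trans p xs Pxs = begin
  filterᵇ p (sort _≤_ xs)
    ≡⟨ cong (filterᵇ p ∘ sort _≤_) (map-proj₁-toList Pxs) ⟨
  filterᵇ p (sort _≤_ (map proj₁ ys))
    ≡⟨ cong (filterᵇ p) (sort-map sort-char _≤_ proj₁ O ys) ⟩
  filterᵇ p (map proj₁ (isort _≤ᴾ_ ys))
    ≡⟨ filterᵇ-map p proj₁ (isort _≤ᴾ_ ys) ⟩
  map proj₁ (filterᵇ (p ∘ proj₁) (isort _≤ᴾ_ ys))
    ≡⟨ cong (map proj₁) (TotalPreorderᵇ.filterᵇ-isort O (p ∘ proj₁) ys) ⟩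
  map proj₁ (isort _≤ᴾ_ (filterᵇ (p ∘ proj₁) ys))
    ≡⟨ sort-map sort-char _≤_ proj₁ O (filterᵇ (p ∘ proj₁) ys) ⟨
  sort _≤_ (map proj₁ (filterᵇ (p ∘ proj₁) ys))
    ≡⟨ cong (sort _≤_) (filterᵇ-map p proj₁ ys) ⟨
  sort _≤_ (filterᵇ p (map proj₁ ys))
    ≡⟨ cong (sort _≤_ ∘ filterᵇ p) (map-proj₁-toList Pxs) ⟩
  sort _≤_ (filterᵇ p xs) ∎
  where
  ys : List (∃ (T ∘ P))
  ys = toList Pxs

  _≤ᴾ_ : ∃ (T ∘ P) → ∃ (T ∘ P) → Bool
  _≤ᴾ_ = _≤_ on proj₁

  O : IsTotalPreorderᵇ _≤ᴾ_
  O = restrict-isTotalPreorderᵇ P _≤_ total trans
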